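{- Let $H$ be the set of harmonic numbers and $\mathcal{F}$ the set of Fermat primes. Then the $abc$-conjecture is true on $H\cup\mathcal{F}$: for every $\varepsilon>0$ there are only finitely many triples $(a,b,c)$ of coprime positive integers with $a,b,c\in H\cup\mathcal{F}$, $a+b=c$ and $c>\operatorname{rad}(abc)^{1+\varepsilon}$.
   Context: A harmonic number is a positive integer of the form $2^a3^b$ with $a,b\ge 0$ integers (so $1$ is harmonic). A Fermat prime is a prime of the form $2^{2^k}+1$ with $k\ge 0$ an integer. For a positive integer $n$, $\operatorname{rad}(n)$ is the product of the distinct primes dividing $n$. Positive integers $a,b,c$ are coprime if they have no common prime factor.
   Formalization: The parameter ε ranges over the positive rationals. -}

module Defs where

open import Data.Nat using (ℕ; suc; _+_; _*_; _^_; _<_; _≤_)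
open import Data.Nat.Divisibility using (_∣_; _∣?_)
open import Data.Nat.Primality using (Prime; prime?)
open import Data.List using (List; filter; upTo)
open import Data.Nat.ListAction using (product)
open import Data.Product using (Σ; ∃; ∃-syntax; _×_; _,_)
open import Data.Sum using (_⊎_)
open import Data.Empty using (⊥)
open import Relation.Nullary.Decidable using (_×-dec_)
open import Relation.Binary.PropositionalEquality using (_≡_)

Harmonic : ℕ → Set
Harmonic n = ∃[ a ] ∃[ b ] (n ≡ 2 ^ a * 3 ^ b)

FermatPrime : ℕ → Set
FermatPrime p = Prime p × ∃[ k ] (p ≡ 2 ^ (2 ^ k) + 1)

InHF : ℕ → Set
InHF n = Harmonic n ⊎ FermatPrime n

rad : ℕ → ℕ
rad n = product (filter (λ p → prime? p ×-dec (p ∣? n)) (upTo (suc n)))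

Coprime3 : ℕ → ℕ → ℕ → Set
Coprime3 a b c = ∀ p → Prime p → p ∣ a → p ∣ b → p ∣ c → ⊥

-- abc-exceptional triple for ε = e / d (d ≥ 1):
-- c > rad(abc)^(1 + e/d)  ⇔  c^d > rad(abc)^(d + e)
Exceptional : ℕ → ℕ → ℕ → ℕ → ℕ → Set
Exceptional e d a b c =
  0 < a × 0 < b × 0 < c × Coprime3 a b c ×
  InHF a × InHF b × InHF c × a + b ≡ c ×
  rad (a * b * c) ^ (d + e) < c ^ d

module Submission where

open import Defs
open import Data.Nat using (ℕ; zero; suc; _+_; _*_; _∸_; _^_; _<_; _≤_; _≟_; _<?_; _≤?_; s≤s; z<s)
open import Data.Nat using (NonZero; nonTrivial⇒n>1; >-nonZero; >-nonZero⁻¹)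
open import Data.Nat.Properties
open import Data.Nat.DivMod using (_%_; _/_; n%1≡0; m≡m%n+[m/n]*n; m%n<n; %-distribˡ-+; %-distribˡ-*)
open import Data.Nat.Divisibility using (_∣_; _∣?_; divides; ∣⇒≤; ∣-refl; m%n≡0⇒n∣m; n∣m⇒m%n≡0)
open import Data.Nat.Divisibility using (m∣m*n; n∣m*n; ∣m⇒∣m*n; ∣n⇒∣m*n; ∣m∣n⇒∣m+n; ∣m+n∣m⇒∣n)
open import Data.Nat.Primality using (Prime; prime?; prime[2]; euclidsLemma; productOfPrimes≢0)
open import Data.Nat.Primality using (prime⇒irreducible; prime⇒nonZero; prime⇒nonTrivial)
open import Data.Nat.Tactic.RingSolver using (solve-∀)
open import Data.Product using (∃-syntax; _×_; _,_; proj₁)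
open import Data.Sum using (_⊎_; inj₁; inj₂)
import Data.Sum as Sum
open import Data.Empty using (⊥; ⊥-elim)
open import Relation.Binary.PropositionalEquality
open import Relation.Nullary using (Dec; yes; no; ¬_; ¬?)
open import Relation.Nullary.Decidable using (True; toWitness; from-yes; _×-dec_; _⊎-dec_; _→-dec_)
open import Data.List using (List; []; _∷_; _++_; map; upTo)
import Data.List.Relation.Unary.All as All
open import Data.List.Relation.Unary.All.Properties using (all-filter)
open import Data.List.Membership.Propositional.Properties using (∈-upTo⁺; ∈-filter⁺)
open import Data.Nat.ListAction.Properties using (∈⇒∣product)
open import Data.Product.Properties using (≡-dec)
open import Data.List.Membership.Propositional using (_∈_)
open import Data.List.Membership.DecPropositional (≡-dec _≟_ (≡-dec _≟_ _≟_)) using (_∈?_)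

-- We show that every exceptional triple lies in an explicit list: eight triples and their swaps.
-- A Fermat prime is either 3 (which is harmonic) or of the form p = 4^(t+1) + 1, so p ≡ 2 (mod 3)
-- and p ≡ 1 (mod 4).  Exceptionality (c > rad(abc)) is used only twice: c cannot be prime, and a
-- Fermat prime p cannot occur with p + 1 = c, since then p and 2 divide rad(abc).  The remaining
-- cases reduce, by coprimality, to exponential equations that are solved completely:
--   * 1 + 2^i = 3^y, 1 + 3^j = 2^x, 5 + 3^j = 2^x and 4^(t+1) + 1 + 3^l = 2^x — small
--     exponents by a bounded search, large ones because the two sides have no common residue
--     modulo a suitable M (powers are periodic modulo M);
--   * p + 2^m = 3^y for such a prime p — reductions modulo 3 and 4 make both exponents even, so
--     p is a difference of squares and primality gives 1 + 2^w = 3^z;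
--   * a sum of two such primes is ≡ 1 (mod 3) and ≡ 2 (mod 4), hence not harmonic.

byEvaluation : ∀ {Q : ℕ → Set} (Q? : ∀ r → Dec (Q r)) R →
  {True (allUpTo? Q? R)} → ∀ {r} → r < R → Q r
byEvaluation Q? R {ok} = toWitness ok

byEvaluation₂ : ∀ {Q : ℕ → ℕ → Set} (Q? : ∀ r s → Dec (Q r s)) R S →
  {True (allUpTo? (λ r → allUpTo? (Q? r) S) R)} → ∀ {r s} → r < R → s < S → Q r s
byEvaluation₂ Q? R S {ok} r<R = toWitness ok r<R

module Congruence (M : ℕ) .{{_ : NonZero M}} where

  infix 4 _≋_
  _≋_ : ℕ → ℕ → Set
  x ≋ y = x % M ≡ y % M

  ≋-+ : ∀ {a b c d} → a ≋ b → c ≋ d → a + c ≋ b + d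
  ≋-+ {a} {b} {c} {d} a≋b c≋d = begin
    (a + c) % M                 ≡⟨ %-distribˡ-+ a c M ⟩
    (a % M + c % M) % M         ≡⟨ cong₂ (λ x y → (x + y) % M) a≋b c≋d ⟩
    (b % M + d % M) % M         ≡⟨ %-distribˡ-+ b d M ⟨
    (b + d) % M                 ∎
    where open ≡-Reasoning

  ≋-* : ∀ {a b c d} → a ≋ b → c ≋ d → a * c ≋ b * d
  ≋-* {a} {b} {c} {d} a≋b c≋d = begin
    (a * c) % M                 ≡⟨ %-distribˡ-* a c M ⟩
    (a % M * (c % M)) % M       ≡⟨ cong₂ (λ x y → (x * y) % M) a≋b c≋d ⟩
    (b % M * (d % M)) % M       ≡⟨ %-distribˡ-* b d M ⟨
    (b * d) % M                 ∎
    where open ≡-Reasoning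

  record Periodic (P : ℕ) .{{_ : NonZero P}} (f : ℕ → ℕ) : Set where
    constructor periodic
    field reduce : ∀ n → f n ≋ f (n % P)
  open Periodic public

  scaledPowerPeriodic : ∀ c b P .{{_ : NonZero P}} → c * b ^ P ≋ c → Periodic P (λ n → c * b ^ n)
  scaledPowerPeriodic c b P cycle = periodic λ n →
    trans (cong (λ m → (c * b ^ m) % M) (m≡m%n+[m/n]*n n P)) (dropPeriods (n % P) (n / P))
    where
    regroup : ∀ r q → c * b ^ (r + (P + q * P)) ≡ c * b ^ P * b ^ (r + q * P)
    regroup r q = begin
      c * b ^ (r + (P + q * P))     ≡⟨ cong (λ m → c * b ^ m) (+-comm r (P + q * P)) ⟩
      c * b ^ ((P + q * P) + r)     ≡⟨ cong (λ m → c * b ^ m) (+-assoc P (q * P) r) ⟩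
      c * b ^ (P + (q * P + r))     ≡⟨ cong (λ m → c * b ^ (P + m)) (+-comm (q * P) r) ⟩
      c * b ^ (P + (r + q * P))     ≡⟨ cong (c *_) (^-distribˡ-+-* b P (r + q * P)) ⟩
      c * (b ^ P * b ^ (r + q * P)) ≡⟨ *-assoc c (b ^ P) _ ⟨
      c * b ^ P * b ^ (r + q * P)   ∎
      where open ≡-Reasoning
    dropPeriods : ∀ r q → c * b ^ (r + q * P) ≋ c * b ^ r
    dropPeriods r zero    = cong (λ m → (c * b ^ m) % M) (+-identityʳ r)
    dropPeriods r (suc q) = begin
      (c * b ^ (r + suc q * P)) % M        ≡⟨ cong (_% M) (regroup r q) ⟩
      (c * b ^ P * b ^ (r + q * P)) % M    ≡⟨ ≋-* cycle refl ⟩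
      (c * b ^ (r + q * P)) % M            ≡⟨ dropPeriods r q ⟩
      (c * b ^ r) % M                      ∎
      where open ≡-Reasoning

  powerPeriodic : ∀ b P .{{_ : NonZero P}} → b ^ P ≋ 1 → Periodic P (b ^_)
  powerPeriodic b P cycle = periodic λ n →
    subst₂ _≋_ (*-identityˡ (b ^ n)) (*-identityˡ (b ^ (n % P)))
      (reduce (scaledPowerPeriodic 1 b P (trans (cong (_% M) (*-identityˡ (b ^ P))) cycle)) n)

  periodic-+ : ∀ k {P} .{{_ : NonZero P}} {f} → Periodic P f → Periodic P (λ n → k + f n)
  periodic-+ k f-periodic = periodic λ n → ≋-+ refl (reduce f-periodic n)

  periodicResidue : ∀ {P} .{{_ : NonZero P}} {f v} (Q : ℕ → Set) → Periodic P f →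
    (∀ {r} → r < P → f r ≋ v → Q r) → ∀ n → f n ≋ v → Q (n % P)
  periodicResidue {P} Q f-periodic onResidues n fn≋v =
    onResidues (m%n<n n P) (trans (sym (reduce f-periodic n)) fn≋v)

  noCommonValue : ∀ {P Q} .{{_ : NonZero P}} .{{_ : NonZero Q}} {f g} →
    Periodic P f → Periodic Q g → (∀ {r s} → r < P → s < Q → ¬ f r ≋ g s) →
    ∀ i j → f i ≢ g j
  noCommonValue {P} {Q} periodicF periodicG distinct i j fi≡gj =
    distinct (m%n<n i P) (m%n<n j Q)
      (trans (sym (reduce periodicF i)) (trans (cong (_% M) fi≡gj) (reduce periodicG j)))

primeAboveOne : ∀ {p} → Prime p → 1 < p
primeAboveOne {p} p-prime = nonTrivial⇒n>1 p {{prime⇒nonTrivial p-prime}}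

splitPower : ∀ b N n → n < N ⊎ ∃[ r ] b ^ n ≡ b ^ N * b ^ r
splitPower b N n with n <? N
... | yes n<N = inj₁ n<N
... | no n≮N  = inj₂ (n ∸ N ,
  trans (cong (b ^_) (sym (m+[n∸m]≡n (≮⇒≥ n≮N)))) (^-distribˡ-+-* b N (n ∸ N)))

exponentBound : ∀ b {y N} .{{_ : NonZero b}} → b ^ y < b ^ N → y < N
exponentBound b lt = ≰⇒> (λ N≤y → <⇒≱ lt (^-monoʳ-≤ b N≤y))

-- Catalan-type equation: 1 + 2^i = 3^y only for (i , y) = (1 , 1) and (3 , 2).
-- For i ≥ 4 the two sides never agree modulo 80 = 16 · 5.
1+pow2≡pow3 : ∀ i y → 1 + 2 ^ i ≡ 3 ^ y → (i ≡ 1 × y ≡ 1) ⊎ (i ≡ 3 × y ≡ 2)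
1+pow2≡pow3 i y e with splitPower 2 4 i
... | inj₁ i<4 = smallCases i<4 y<3 e
  where
  y<3 : y < 3
  y<3 = exponentBound 3 (subst (_< 3 ^ 3) e
          (≤-<-trans (+-monoʳ-≤ 1 (^-monoʳ-≤ 2 (≤-pred i<4))) (from-yes (9 <? 27))))
  smallCases : ∀ {i y} → i < 4 → y < 3 → 1 + 2 ^ i ≡ 3 ^ y → (i ≡ 1 × y ≡ 1) ⊎ (i ≡ 3 × y ≡ 2)
  smallCases = byEvaluation₂
    (λ i y → (1 + 2 ^ i ≟ 3 ^ y) →-dec ((i ≟ 1 ×-dec y ≟ 1) ⊎-dec (i ≟ 3 ×-dec y ≟ 2))) 4 3
... | inj₂ (r , 2^i≡16*2^r) = ⊥-elim (distinctMod80 r y (trans (cong (1 +_) (sym 2^i≡16*2^r)) e))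
  where
  open Congruence 80
  distinctMod80 : ∀ r y → 1 + 16 * 2 ^ r ≢ 3 ^ y
  distinctMod80 = noCommonValue (periodic-+ 1 (scaledPowerPeriodic 16 2 4 refl)) (powerPeriodic 3 4 refl)
    (byEvaluation₂ (λ r s → ¬? ((1 + 16 * 2 ^ r) % 80 ≟ 3 ^ s % 80)) 4 4)

-- 1 + 3^j is 2 or 4 modulo 8, so never divisible by 8.
8∤1+pow3 : ∀ j → ¬ 8 ∣ 1 + 3 ^ j
8∤1+pow3 j 8∣1+3^j =
  periodicResidue {v = 0} (λ _ → ⊥) (periodic-+ 1 (powerPeriodic 3 2 refl))
    (byEvaluation (λ r → ¬? ((1 + 3 ^ r) % 8 ≟ 0)) 2) j (n∣m⇒m%n≡0 _ 8 8∣1+3^j)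
  where open Congruence 8

1+pow3≡pow2 : ∀ j x → 1 + 3 ^ j ≡ 2 ^ x → (j ≡ 0 × x ≡ 1) ⊎ (j ≡ 1 × x ≡ 2)
1+pow3≡pow2 j x e with splitPower 2 3 x
... | inj₁ x<3 = smallCases j<2 x<3 e
  where
  j<2 : j < 2
  j<2 = exponentBound 3 (≤-trans (≤-reflexive e) (≤-trans (^-monoʳ-≤ 2 (≤-pred x<3)) (from-yes (4 ≤? 9))))
  smallCases : ∀ {j x} → j < 2 → x < 3 → 1 + 3 ^ j ≡ 2 ^ x → (j ≡ 0 × x ≡ 1) ⊎ (j ≡ 1 × x ≡ 2)
  smallCases = byEvaluation₂
    (λ j x → (1 + 3 ^ j ≟ 2 ^ x) →-dec ((j ≟ 0 ×-dec x ≟ 1) ⊎-dec (j ≟ 1 ×-dec x ≟ 2))) 2 3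
... | inj₂ (r , 2^x≡8*2^r) =
  ⊥-elim (8∤1+pow3 j (divides (2 ^ r) (trans e (trans 2^x≡8*2^r (*-comm 8 (2 ^ r))))))

-- 5 + 3^j = 2^x only for (j , x) = (1 , 3) and (3 , 5).
-- For x ≥ 6 the two sides never agree modulo 1088 = 64 · 17.
5+pow3≡pow2 : ∀ j x → 5 + 3 ^ j ≡ 2 ^ x → (j ≡ 1 × x ≡ 3) ⊎ (j ≡ 3 × x ≡ 5)
5+pow3≡pow2 j x e with splitPower 2 6 x
... | inj₁ x<6 = smallCases j<4 x<6 e
  where
  j<4 : j < 4
  j<4 = exponentBound 3 (<-≤-trans (<-≤-trans (m<n+m (3 ^ j) {5} z<s) (≤-reflexive e))
          (≤-trans (^-monoʳ-≤ 2 (≤-pred x<6)) (from-yes (32 ≤? 81))))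
  smallCases : ∀ {j x} → j < 4 → x < 6 → 5 + 3 ^ j ≡ 2 ^ x → (j ≡ 1 × x ≡ 3) ⊎ (j ≡ 3 × x ≡ 5)
  smallCases = byEvaluation₂
    (λ j x → (5 + 3 ^ j ≟ 2 ^ x) →-dec ((j ≟ 1 ×-dec x ≟ 3) ⊎-dec (j ≟ 3 ×-dec x ≟ 5))) 4 6
... | inj₂ (r , 2^x≡64*2^r) = ⊥-elim (distinctMod1088 j r (trans e 2^x≡64*2^r))
  where
  open Congruence 1088
  distinctMod1088 : ∀ j r → 5 + 3 ^ j ≢ 64 * 2 ^ r
  distinctMod1088 = noCommonValue (periodic-+ 5 (powerPeriodic 3 16 refl)) (scaledPowerPeriodic 64 2 8 refl)
    (byEvaluation₂ (λ r s → ¬? ((5 + 3 ^ r) % 1088 ≟ 64 * 2 ^ s % 1088)) 16 8)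

-- A Fermat number 4^(t+1) + 1 plus a power of 3 is a power of 2 only for 5 + 3 = 8 and 5 + 27 = 32:
-- for t ≥ 1 the left side is at least 16 and is 2 or 4 modulo 8.
fermat+pow3≡pow2 : ∀ {p} t l x → p ≡ 4 ^ suc t + 1 → p + 3 ^ l ≡ 2 ^ x →
  p ≡ 5 × ((l ≡ 1 × x ≡ 3) ⊎ (l ≡ 3 × x ≡ 5))
fermat+pow3≡pow2 zero    l x refl e = refl , 5+pow3≡pow2 l x e
fermat+pow3≡pow2 (suc t) l x refl e with splitPower 2 3 x
... | inj₁ x<3 = ⊥-elim (<⇒≱ (from-yes (4 <? 16))
        (≤-trans 16≤lhs (≤-trans (≤-reflexive e) (^-monoʳ-≤ 2 (≤-pred x<3)))))
  where
  16≤lhs : 16 ≤ 4 ^ suc (suc t) + 1 + 3 ^ l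
  16≤lhs = ≤-trans (*-monoʳ-≤ 4 (*-monoʳ-≤ 4 (m^n>0 4 t))) (≤-trans (m≤m+n _ 1) (m≤m+n _ (3 ^ l)))
... | inj₂ (r , 2^x≡8*2^r) = ⊥-elim (8∤1+pow3 l (∣m+n∣m⇒∣n 8∣lhs 8∣16*4^t))
  where
  8∣lhs : 8 ∣ 4 ^ suc (suc t) + (1 + 3 ^ l)
  8∣lhs = divides (2 ^ r) (trans (sym (+-assoc _ 1 (3 ^ l))) (trans e (trans 2^x≡8*2^r (*-comm 8 (2 ^ r)))))
  8∣16*4^t : 8 ∣ 4 ^ suc (suc t)
  8∣16*4^t = divides (2 * 4 ^ t) (regroup (4 ^ t))
    where
    regroup : ∀ X → 4 * (4 * X) ≡ 2 * X * 8
    regroup = solve-∀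

-- If a prime factors as r (2v + r) then r = 1: otherwise r = p and p < p (2v + p).
primeFactorisation : ∀ {p} r v → Prime p → p ≡ r * (2 * v + r) → r ≡ 1
primeFactorisation {p} r v p-prime p≡r*[2v+r]
  with prime⇒irreducible p-prime (divides (2 * v + r) (trans p≡r*[2v+r] (*-comm r _)))
... | inj₁ r≡1 = r≡1
... | inj₂ refl = ⊥-elim (<-irrefl p≡r*[2v+r]
        (m<m*n r (2 * v + r) {{prime⇒nonZero p-prime}} (≤-trans (primeAboveOne p-prime) (m≤n+m r (2 * v)))))

-- A prime p with p + v² = u² has u = v + 1: writing u = v + r gives p = r (2v + r).
primeSquareGap : ∀ {p u v} → Prime p → p + v * v ≡ u * u → suc v ≡ u
primeSquareGap {p} {u} {v} p-prime e with u ≤? v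
... | yes u≤v = ⊥-elim (<⇒≱ (subst (v * v <_) e (m<n+m (v * v) (<⇒≤ (primeAboveOne p-prime))))
                               (*-mono-≤ u≤v u≤v))
... | no u≰v = trans (+-comm 1 v) (subst (λ r → v + r ≡ u) (primeFactorisation r v p-prime p≡r*[2v+r]) v+r≡u)
  where
  r : ℕ
  r = u ∸ v
  v+r≡u : v + r ≡ u
  v+r≡u = m+[n∸m]≡n (<⇒≤ (≰⇒> u≰v))
  expand : ∀ v r → (v + r) * (v + r) ≡ r * (2 * v + r) + v * v
  expand = solve-∀
  p≡r*[2v+r] : p ≡ r * (2 * v + r)
  p≡r*[2v+r] = +-cancelʳ-≡ (v * v) p _ (trans e (trans (cong (λ w → w * w) (sym v+r≡u)) (expand v r)))

pow-double : ∀ b n → b ^ (n * 2) ≡ b ^ n * b ^ n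
pow-double b n = trans (sym (^-*-assoc b n 2)) (cong (b ^ n *_) (*-identityʳ (b ^ n)))

-- A prime p with p + (2^w)² = (3^z)² is 5 = 9 - 4 or 17 = 81 - 64, since then 1 + 2^w = 3^z.
primeSquareDifference : ∀ {p} w z → Prime p → p + 2 ^ w * 2 ^ w ≡ 3 ^ z * 3 ^ z →
  (p ≡ 5 × w ≡ 1 × z ≡ 1) ⊎ (p ≡ 17 × w ≡ 3 × z ≡ 2)
primeSquareDifference {p} w z p-prime e with 1+pow2≡pow3 w z (primeSquareGap p-prime e)
... | inj₁ (refl , refl) = inj₁ (+-cancelʳ-≡ 4 p 5 e , refl , refl)
... | inj₂ (refl , refl) = inj₂ (+-cancelʳ-≡ 64 p 17 e , refl , refl)

-- If p ≡ 2 (mod 3) and p + 2^m is a positive power of 3, then 2^m ≡ 1 (mod 3), so m is even.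
evenExponentMod3 : ∀ {p} m y → p % 3 ≡ 2 → p + 2 ^ m ≡ 3 ^ suc y → 2 ∣ m
evenExponentMod3 {p} m y p%3≡2 e = m%n≡0⇒n∣m m 2
  (periodicResidue {v = 0} (_≡ 0) (periodic-+ 2 (powerPeriodic 2 2 refl))
    (byEvaluation (λ r → ((2 + 2 ^ r) % 3 ≟ 0) →-dec (r ≟ 0)) 2) m 2+2^m≋0)
  where
  open Congruence 3
  2+2^m≋0 : 2 + 2 ^ m ≋ 0
  2+2^m≋0 = trans (sym (≋-+ {p} {2} {2 ^ m} {2 ^ m} p%3≡2 refl))
                  (n∣m⇒m%n≡0 _ 3 (subst (3 ∣_) (sym e) (m∣m*n (3 ^ y))))

-- If p ≡ 1 (mod 4) and p + 2^(2+n) = 3^y, then 3^y ≡ 1 (mod 4), so y is even.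
evenExponentMod4 : ∀ {p} n y → p % 4 ≡ 1 → p + 2 ^ (2 + n) ≡ 3 ^ y → 2 ∣ y
evenExponentMod4 {p} n y p%4≡1 e = m%n≡0⇒n∣m y 2
  (periodicResidue {v = 1} (_≡ 0) (powerPeriodic 3 2 refl)
    (byEvaluation (λ r → (3 ^ r % 4 ≟ 1) →-dec (r ≟ 0)) 2) y 3^y≋1)
  where
  open Congruence 4
  regroup : ∀ X → 2 * (2 * X) ≡ X * 4
  regroup = solve-∀
  3^y≋1 : 3 ^ y ≋ 1
  3^y≋1 = trans (cong (_% 4) (sym e))
            (≋-+ {p} {1} {2 ^ (2 + n)} {0} p%4≡1 (n∣m⇒m%n≡0 _ 4 (divides (2 ^ n) (regroup (2 ^ n)))))

asSquares : ∀ {p} w y z → p + 2 ^ (w * 2) ≡ 3 ^ y → y ≡ z * 2 → p + 2 ^ w * 2 ^ w ≡ 3 ^ z * 3 ^ z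
asSquares {p} w y z e refl = begin
  p + 2 ^ w * 2 ^ w  ≡⟨ cong (p +_) (pow-double 2 w) ⟨
  p + 2 ^ (w * 2)    ≡⟨ e ⟩
  3 ^ (z * 2)        ≡⟨ pow-double 3 z ⟩
  3 ^ z * 3 ^ z      ∎
  where open ≡-Reasoning

-- p + 2^m = 3^y, for a prime p ≡ 2 (mod 3), p ≡ 1 (mod 4) and m ≥ 1, only for 5 + 4 = 9 and
-- 17 + 64 = 81: reducing modulo 3 and 4 shows m and y even, so p is a difference of squares.
prime+pow2≡pow3 : ∀ {p} m y → Prime p → p % 3 ≡ 2 → p % 4 ≡ 1 → 0 < m → p + 2 ^ m ≡ 3 ^ y →
  (p ≡ 5 × m ≡ 2 × y ≡ 2) ⊎ (p ≡ 17 × m ≡ 6 × y ≡ 4)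
prime+pow2≡pow3 {p} m zero p-prime _ _ _ e =
  ⊥-elim (<⇒≱ (primeAboveOne p-prime) (≤-trans (m≤m+n p (2 ^ m)) (≤-reflexive e)))
prime+pow2≡pow3 {p} m (suc y) p-prime p%3≡2 p%4≡1 m>0 e with evenExponentMod3 {p} m y p%3≡2 e
... | divides zero refl = ⊥-elim (<-irrefl refl m>0)
... | divides (suc w) refl with evenExponentMod4 {p} (w * 2) (suc y) p%4≡1 e
...   | divides z y≡z*2 with primeSquareDifference (suc w) z p-prime (asSquares {p} (suc w) (suc y) z e y≡z*2)
...     | inj₁ (p≡5 , refl , refl)  = inj₁ (p≡5 , refl , y≡z*2)
...     | inj₂ (p≡17 , refl , refl) = inj₂ (p≡17 , refl , y≡z*2)

-- A Fermat prime other than 3 = 2^(2^0) + 1, written as 4^(t+1) + 1.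
LargeFermat : ℕ → Set
LargeFermat n = Prime n × ∃[ t ] n ≡ 4 ^ suc t + 1

fermatExponent : ∀ k → 2 ^ (2 ^ suc k) ≡ 4 ^ suc (2 ^ k ∸ 1)
fermatExponent k = begin
  2 ^ (2 * 2 ^ k)          ≡⟨ ^-*-assoc 2 2 (2 ^ k) ⟨
  4 ^ (2 ^ k)              ≡⟨ cong (4 ^_) (m+[n∸m]≡n (m^n>0 2 k)) ⟨
  4 ^ suc (2 ^ k ∸ 1)      ∎
  where open ≡-Reasoning

harmonicOrLargeFermat : ∀ {n} → InHF n → Harmonic n ⊎ LargeFermat n
harmonicOrLargeFermat (inj₁ n-harmonic) = inj₁ n-harmonic
harmonicOrLargeFermat (inj₂ (_ , zero , n≡3)) = inj₁ (0 , 1 , n≡3)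
harmonicOrLargeFermat (inj₂ (n-prime , suc k , n≡F)) =
  inj₂ (n-prime , 2 ^ k ∸ 1 , trans n≡F (cong (_+ 1) (fermatExponent k)))

-- Fermat primes 4^(t+1) + 1 are ≡ 2 (mod 3), since 4 ≡ 1, and ≡ 1 (mod 4).
fermat%3 : ∀ {p} → LargeFermat p → p % 3 ≡ 2
fermat%3 (_ , t , refl) = ≋-+ {4 ^ suc t} {1} {1} {1} 4^n≋1 refl
  where
  open Congruence 3
  4^n≋1 : 4 ^ suc t ≋ 1
  4^n≋1 = trans (reduce (powerPeriodic 4 1 refl) (suc t)) (cong (λ k → 4 ^ k % 3) (n%1≡0 (suc t)))

fermat%4 : ∀ {p} → LargeFermat p → p % 4 ≡ 1
fermat%4 (_ , t , refl) = ≋-+ {4 ^ suc t} {0} {1} {1} (n∣m⇒m%n≡0 _ 4 (m∣m*n (4 ^ t))) refl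
  where open Congruence 4

primeSum>2 : ∀ {p q} → Prime p → Prime q → ¬ p + q ≤ 2
primeSum>2 p-prime q-prime =
  <⇒≱ (≤-trans (from-yes (3 ≤? 4)) (+-mono-≤ (primeAboveOne p-prime) (primeAboveOne q-prime)))

-- The sum of two primes that are ≡ 2 (mod 3) and ≡ 1 (mod 4) is not harmonic:
-- it is ≡ 1 (mod 3), ≡ 2 (mod 4) and larger than 2.
primeSum-notHarmonic : ∀ {p q} → Prime p → Prime q → p % 3 ≡ 2 → q % 3 ≡ 2 → p % 4 ≡ 1 → q % 4 ≡ 1 →
  ¬ Harmonic (p + q)
primeSum-notHarmonic {p} {q} _ _ p%3≡2 q%3≡2 _ _ (x , suc y , e) =
  1≢0 (trans (sym (≋-+ {p} {2} {q} {2} p%3≡2 q%3≡2))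
             (n∣m⇒m%n≡0 _ 3 (subst (3 ∣_) (sym e) (∣n⇒∣m*n (2 ^ x) (m∣m*n (3 ^ y))))))
  where
  open Congruence 3
  1≢0 : 1 ≢ 0
  1≢0 ()
primeSum-notHarmonic {p} {q} _ _ _ _ p%4≡1 q%4≡1 (suc (suc x) , zero , e) =
  2≢0 (trans (sym (≋-+ {p} {1} {q} {1} p%4≡1 q%4≡1))
             (n∣m⇒m%n≡0 _ 4 (subst (4 ∣_) (sym e) (∣m⇒∣m*n 1 (divides (2 ^ x) (regroup (2 ^ x)))))))
  where
  open Congruence 4
  regroup : ∀ X → 2 * (2 * X) ≡ X * 4
  regroup = solve-∀
  2≢0 : 2 ≢ 0
  2≢0 ()
primeSum-notHarmonic p-prime q-prime _ _ _ _ (0 , zero , e) =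
  primeSum>2 p-prime q-prime (≤-trans (≤-reflexive e) (from-yes (1 ≤? 2)))
primeSum-notHarmonic p-prime q-prime _ _ _ _ (1 , zero , e) = primeSum>2 p-prime q-prime (≤-reflexive e)

harmonic : ℕ → ℕ → ℕ
harmonic i j = 2 ^ i * 3 ^ j

harmonic>0 : ∀ i j → 0 < harmonic i j
harmonic>0 i j = *-mono-≤ (m^n>0 2 i) (m^n>0 3 j)

harmonic-2 : ∀ i → harmonic i 0 ≡ 2 ^ i
harmonic-2 i = *-identityʳ (2 ^ i)

harmonic-3 : ∀ j → harmonic 0 j ≡ 3 ^ j
harmonic-3 j = *-identityˡ (3 ^ j)

positiveSum≢1 : ∀ {a b} → 0 < a → 0 < b → a + b ≢ 1
positiveSum≢1 {suc a} (s≤s _) (s≤s _) e = m+1+n≢0 a (suc-injective e)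

Coprime₂ : ℕ → ℕ → Set
Coprime₂ a b = ∀ p → Prime p → p ∣ a → p ∣ b → ⊥

-- In a + b = c, a prime dividing two of a, b, c divides the third, so a coprime triple is
-- pairwise coprime.
coprime-ab : ∀ {a b c} → Coprime3 a b c → a + b ≡ c → Coprime₂ a b
coprime-ab coprime e p p-prime p∣a p∣b = coprime p p-prime p∣a p∣b (subst (p ∣_) e (∣m∣n⇒∣m+n p∣a p∣b))

coprime-ac : ∀ {a b c} → Coprime3 a b c → a + b ≡ c → Coprime₂ a c
coprime-ac coprime e p p-prime p∣a p∣c =
  coprime p p-prime p∣a (∣m+n∣m⇒∣n (subst (p ∣_) (sym e) p∣c) p∣a) p∣c

coprime-bc : ∀ {a b c} → Coprime3 a b c → a + b ≡ c → Coprime₂ b c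
coprime-bc {a} {b} coprime e p p-prime p∣b p∣c =
  coprime p p-prime (∣m+n∣m⇒∣n (subst (p ∣_) (sym (trans (+-comm b a) e)) p∣c) p∣b) p∣b p∣c

coprimeTwos : ∀ i j k l → Coprime₂ (harmonic i j) (harmonic k l) → i ≡ 0 ⊎ k ≡ 0
coprimeTwos zero    j k       l _ = inj₁ refl
coprimeTwos (suc i) j zero    l _ = inj₂ refl
coprimeTwos (suc i) j (suc k) l coprime =
  ⊥-elim (coprime 2 prime[2] (∣m⇒∣m*n (3 ^ j) (m∣m*n (2 ^ i))) (∣m⇒∣m*n (3 ^ l) (m∣m*n (2 ^ k))))

coprimeThrees : ∀ i j k l → Coprime₂ (harmonic i j) (harmonic k l) → j ≡ 0 ⊎ l ≡ 0
coprimeThrees i zero    k l       _ = inj₁ refl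
coprimeThrees i (suc j) k zero    _ = inj₂ refl
coprimeThrees i (suc j) k (suc l) coprime =
  ⊥-elim (coprime 3 (from-yes (prime? 3))
    (∣n⇒∣m*n (2 ^ i) (m∣m*n (3 ^ j))) (∣n⇒∣m*n (2 ^ k) (m∣m*n (3 ^ l))))

partnerPositive : ∀ {i x} → i ≡ 0 ⊎ suc x ≡ 0 → i ≡ 0
partnerPositive (inj₁ i≡0) = i≡0
partnerPositive (inj₂ ())

-- In a pairwise coprime harmonic solution of a + b = c one summand is 1: c > 1 is divisible by
-- 2 or by 3, that prime divides neither a nor b, and the other prime divides at most one of them.
unitSummand : ∀ i j k l x y →
  Coprime₂ (harmonic i j) (harmonic k l) → Coprime₂ (harmonic i j) (harmonic x y) →
  Coprime₂ (harmonic k l) (harmonic x y) → harmonic i j + harmonic k l ≡ harmonic x y →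
  (i ≡ 0 × j ≡ 0) ⊎ (k ≡ 0 × l ≡ 0)
unitSummand i j k l (suc x) y coprime-ab coprime-ac coprime-bc _ =
  Sum.map (partnerPositive (coprimeTwos i j (suc x) y coprime-ac) ,_)
          (partnerPositive (coprimeTwos k l (suc x) y coprime-bc) ,_) (coprimeThrees i j k l coprime-ab)
unitSummand i j k l zero (suc y) coprime-ab coprime-ac coprime-bc _ =
  Sum.map (_, partnerPositive (coprimeThrees i j zero (suc y) coprime-ac))
          (_, partnerPositive (coprimeThrees k l zero (suc y) coprime-bc)) (coprimeTwos i j k l coprime-ab)
unitSummand i j k l zero zero _ _ _ e = ⊥-elim (positiveSum≢1 (harmonic>0 i j) (harmonic>0 k l) e)

swapSummands : ℕ × ℕ × ℕ → ℕ × ℕ × ℕ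
swapSummands (a , b , c) = (b , a , c)

-- Up to exchanging a and b, every coprime a + b = c in H ∪ F not ruled out by the radical bound:
-- 1 + 1 = 2, 2 + 1 = 3, 8 + 1 = 9, 3 + 1 = 4, 5 + 3 = 8, 5 + 27 = 32, 5 + 4 = 9, 17 + 64 = 81.
solutions : List (ℕ × ℕ × ℕ)
solutions = base ++ map swapSummands base
  where
  base : List (ℕ × ℕ × ℕ)
  base = (1 , 1 , 2) ∷ (2 , 1 , 3) ∷ (8 , 1 , 9) ∷ (3 , 1 , 4) ∷
         (5 , 3 , 8) ∷ (5 , 27 , 32) ∷ (5 , 4 , 9) ∷ (17 , 64 , 81) ∷ []

listed : ∀ t → {True (t ∈? solutions)} → t ∈ solutions
listed t {t∈solutions} = toWitness t∈solutions

swapListed : ∀ {t} → t ∈ solutions → swapSummands t ∈ solutions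
swapListed = All.lookup (from-yes (All.all? (λ t → swapSummands t ∈? solutions) solutions))

harmonicPlusOne : ∀ i j x y → Coprime₂ (harmonic i j) (harmonic x y) → harmonic i j + 1 ≡ harmonic x y →
  (harmonic i j , 1 , harmonic x y) ∈ solutions
harmonicPlusOne i j x y coprime e with coprimeTwos i j x y coprime | coprimeThrees i j x y coprime
... | inj₁ refl | inj₁ refl = subst (λ c → (1 , 1 , c) ∈ solutions) e (listed _)
... | inj₁ refl | inj₂ refl
  with 1+pow3≡pow2 j x (trans (+-comm 1 _) (subst₂ (λ a c → a + 1 ≡ c) (harmonic-3 j) (harmonic-2 x) e))
...   | inj₁ (refl , refl) = listed _
...   | inj₂ (refl , refl) = listed _
harmonicPlusOne i j x y coprime e | inj₂ refl | inj₁ refl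
  with 1+pow2≡pow3 i y (trans (+-comm 1 _) (subst₂ (λ a c → a + 1 ≡ c) (harmonic-2 i) (harmonic-3 y) e))
...   | inj₁ (refl , refl) = listed _
...   | inj₂ (refl , refl) = listed _
harmonicPlusOne i j x y coprime e | inj₂ refl | inj₂ refl = ⊥-elim (positiveSum≢1 (harmonic>0 i j) z<s e)

-- Coprime triples a + b = c of harmonic numbers: one summand is 1, so harmonicPlusOne applies.
harmonicTriple : ∀ {a b c} → Coprime3 a b c → a + b ≡ c → Harmonic a → Harmonic b → Harmonic c →
  (a , b , c) ∈ solutions
harmonicTriple coprime e (i , j , refl) (k , l , refl) (x , y , refl)
  with unitSummand i j k l x y (coprime-ab coprime e) (coprime-ac coprime e) (coprime-bc coprime e) e
... | inj₂ (refl , refl) = harmonicPlusOne i j x y (coprime-ac coprime e) e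
... | inj₁ (refl , refl) = swapListed (harmonicPlusOne k l x y (coprime-bc coprime e) (trans (+-comm _ 1) e))

fermatPlusHarmonic : ∀ {p} k l x y → LargeFermat p → Coprime₂ (harmonic k l) (harmonic x y) →
  p + harmonic k l ≡ harmonic x y → (k ≡ 0 × l ≡ 0) ⊎ (p , harmonic k l , harmonic x y) ∈ solutions
fermatPlusHarmonic {p} k l x y fermat@(p-prime , t , p≡F) coprime e
  with coprimeTwos k l x y coprime | coprimeThrees k l x y coprime
... | inj₁ refl | inj₁ refl = inj₁ (refl , refl)
... | inj₁ refl | inj₂ refl
  with fermat+pow3≡pow2 t l x p≡F (subst₂ (λ b c → p + b ≡ c) (harmonic-3 l) (harmonic-2 x) e)
...   | refl , inj₁ (refl , refl) = inj₂ (listed _)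
...   | refl , inj₂ (refl , refl) = inj₂ (listed _)
fermatPlusHarmonic zero l x y _ coprime e | inj₂ refl | inj₁ refl = inj₁ (refl , refl)
fermatPlusHarmonic {p} (suc k) l x y fermat@(p-prime , _) coprime e | inj₂ refl | inj₁ refl
  with prime+pow2≡pow3 (suc k) y p-prime (fermat%3 fermat) (fermat%4 fermat) z<s
         (subst₂ (λ b c → p + b ≡ c) (harmonic-2 (suc k)) (harmonic-3 y) e)
...   | inj₁ (refl , refl , refl) = inj₂ (listed _)
...   | inj₂ (refl , refl , refl) = inj₂ (listed _)
fermatPlusHarmonic k l x y (p-prime , _) coprime e | inj₂ refl | inj₂ refl =
  ⊥-elim (positiveSum≢1 (<⇒≤ (primeAboveOne p-prime)) (harmonic>0 k l) e)

prime∣rad : ∀ {n p} → 0 < n → Prime p → p ∣ n → p ∣ rad n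
prime∣rad {n} n>0 p-prime p∣n = ∈⇒∣product (∈-filter⁺ (λ q → prime? q ×-dec (q ∣? n))
  (∈-upTo⁺ (s≤s (∣⇒≤ {{>-nonZero n>0}} p∣n))) (p-prime , p∣n))

rad>0 : ∀ n → 0 < rad n
rad>0 n = >-nonZero⁻¹ (rad n)
  {{productOfPrimes≢0 (All.map proj₁ (all-filter (λ q → prime? q ×-dec (q ∣? n)) (upTo (suc n))))}}

distinctPrimeDivisors : ∀ {p q n} → Prime p → Prime q → q ≢ p → p ∣ n → q ∣ n → 0 < n → q * p ≤ n
distinctPrimeDivisors _ _ _ (divides zero refl) _ ()
distinctPrimeDivisors {p} {q} p-prime q-prime q≢p (divides s@(suc _) refl) q∣n _
  with euclidsLemma s p q-prime q∣n
... | inj₁ q∣s = *-monoˡ-≤ p (∣⇒≤ q∣s)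
... | inj₂ q∣p with prime⇒irreducible p-prime q∣p
...   | inj₁ q≡1 = ⊥-elim (<-irrefl (sym q≡1) (primeAboveOne q-prime))
...   | inj₂ q≡p = ⊥-elim (q≢p q≡p)

-- If a Fermat prime p > 3 and 2 both divide m > 0, then p + 1 < 2p ≤ m.
fermat+1≤ : ∀ {p m} → LargeFermat p → 0 < m → p ∣ m → 2 ∣ m → p + 1 ≤ m
fermat+1≤ {p} fermat@(p-prime , _) m>0 p∣m 2∣m =
  ≤-trans (+-monoʳ-≤ p (≤-trans (<⇒≤ (primeAboveOne p-prime)) (m≤m+n p 0)))
          (distinctPrimeDivisors p-prime prime[2] 2≢p p∣m 2∣m m>0)
  where
  2≢p : 2 ≢ p
  2≢p 2≡p with subst (λ n → n % 4 ≡ 1) (sym 2≡p) (fermat%4 fermat)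
  ... | ()

fermat+1-even : ∀ {p} → LargeFermat p → 2 ∣ p + 1
fermat+1-even (_ , t , refl) = divides (2 * 4 ^ t + 1) (regroup (4 ^ t))
  where
  regroup : ∀ X → 4 * X + 1 + 1 ≡ (2 * X + 1) * 2
  regroup = solve-∀

-- In an exceptional triple c exceeds rad(abc): otherwise c^d ≤ rad^d ≤ rad^(d+e).
radBelow : ∀ e d {a b c} → Exceptional e d a b c → rad (a * b * c) < c
radBelow e d {a} {b} {c} (_ , _ , _ , _ , _ , _ , _ , _ , rad^[d+e]<c^d) = ≰⇒> λ c≤rad →
  <⇒≱ rad^[d+e]<c^d (≤-trans (^-monoˡ-≤ d c≤rad)
    (^-monoʳ-≤ (rad (a * b * c)) {{>-nonZero (rad>0 (a * b * c))}} (m≤m+n d e)))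

exceptionalPrime∣rad : ∀ e d {a b c p} → Exceptional e d a b c →
  Prime p → p ∣ a * b * c → p ∣ rad (a * b * c)
exceptionalPrime∣rad _ _ (a>0 , b>0 , c>0 , _) = prime∣rad (*-mono-≤ (*-mono-≤ a>0 b>0) c>0)

swapExceptional : ∀ e d {a b c} → Exceptional e d a b c → Exceptional e d b a c
swapExceptional e d {a} {b} {c} (a>0 , b>0 , c>0 , coprime , inA , inB , inC , a+b≡c , big) =
  b>0 , a>0 , c>0 , (λ p p-prime p∣b p∣a → coprime p p-prime p∣a p∣b) , inB , inA , inC ,
  trans (+-comm b a) a+b≡c , subst (λ n → rad n ^ (d + e) < c ^ d) (cong (_* c) (*-comm a b)) big

-- In an exceptional triple c is not prime, for then c ≤ rad(abc).
exceptional-c-notPrime : ∀ e d {a b c} → Exceptional e d a b c → ¬ Prime c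
exceptional-c-notPrime e d {a} {b} {c} ex c-prime =
  <⇒≱ (radBelow e d ex)
    (∣⇒≤ {{>-nonZero (rad>0 (a * b * c))}} (exceptionalPrime∣rad e d ex c-prime (n∣m*n (a * b))))

-- Exceptional triples whose first summand is a Fermat prime p > 3 and the others harmonic.
-- The case b = 1 is excluded by the radical: c = p + 1 ≤ rad(abc), as p and 2 divide abc.
fermatCase : ∀ e d {a b c} → Exceptional e d a b c → LargeFermat a → Harmonic b → Harmonic c →
  (a , b , c) ∈ solutions
fermatCase e d {a} ex@(_ , _ , _ , coprime , _ , _ , _ , a+b≡c , _) fermat (k , l , refl) (x , y , refl)
  with fermatPlusHarmonic k l x y fermat (coprime-bc coprime a+b≡c) a+b≡c
... | inj₂ listedTriple = listedTriple
... | inj₁ (refl , refl) = ⊥-elim (<⇒≱ (radBelow e d ex) (subst (_≤ rad abc) a+b≡c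
        (fermat+1≤ fermat (rad>0 abc) a∣rad 2∣rad)))
  where
  abc : ℕ
  abc = a * 1 * harmonic x y
  a∣rad : a ∣ rad abc
  a∣rad = exceptionalPrime∣rad e d ex (proj₁ fermat) (∣m⇒∣m*n (harmonic x y) (∣m⇒∣m*n 1 ∣-refl))
  2∣rad : 2 ∣ rad abc
  2∣rad = exceptionalPrime∣rad e d ex prime[2] (∣n⇒∣m*n (a * 1) (subst (2 ∣_) a+b≡c (fermat+1-even fermat)))

-- Every exceptional triple is listed: c is not prime, hence harmonic, and then a and b are
-- both harmonic, or one of them is a Fermat prime > 3 (both cannot be, by their residues).
exceptionalListed : ∀ e d {a b c} → Exceptional e d a b c → (a , b , c) ∈ solutions
exceptionalListed e d ex@(_ , _ , _ , coprime , inA , inB , inC , a+b≡c , _)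
  with harmonicOrLargeFermat inA | harmonicOrLargeFermat inB | harmonicOrLargeFermat inC
... | _       | _       | inj₂ (c-prime , _) = ⊥-elim (exceptional-c-notPrime e d ex c-prime)
... | inj₁ hA | inj₁ hB | inj₁ hC = harmonicTriple coprime a+b≡c hA hB hC
... | inj₂ fA | inj₁ hB | inj₁ hC = fermatCase e d ex fA hB hC
... | inj₁ hA | inj₂ fB | inj₁ hC = swapListed (fermatCase e d (swapExceptional e d ex) fB hA hC)
... | inj₂ fA | inj₂ fB | inj₁ hC = ⊥-elim (primeSum-notHarmonic (proj₁ fA) (proj₁ fB)
        (fermat%3 fA) (fermat%3 fB) (fermat%4 fA) (fermat%4 fB) (subst Harmonic (sym a+b≡c) hC))

corollary2p7 : (e d : ℕ) → 0 < e → 0 < d →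
    ∃[ L ] (∀ a b c → Exceptional e d a b c → (a , b , c) ∈ L)
corollary2p7 e d _ _ = solutions , λ a b c → exceptionalListed e d
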